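{- For every axiom $A$ of $\mathrm{PA}^\omega$, $\mathrm{PA}^\omega_r\vdash A^r$.
   Context: Logic: sorts $\sigma::=\iota\mid\sigma\to\tau$; formulas $P(\vec t)\mid\bot\mid A\Rightarrow B\mid A\wedge B\mid\forall xA$, $\neg A:=A\Rightarrow\bot$; predicates are negative or positive; negative formulas $N::=P(\vec t)$ ($P$ negative) $\mid\bot\mid A\Rightarrow N\mid N\wedge N'\mid\forall xN$. Sequents $\Gamma\vdash A\mid\Delta$ (all of $\Delta$ negative) are derived by identity, axioms, intro/elim rules for $\Rightarrow,\wedge,\forall$, and: from $\Gamma\vdash N\mid\Delta,N$ infer $\Gamma\vdash\bot\mid\Delta,N$; from $\Gamma\vdash\bot\mid\Delta,N$ infer $\Gamma\vdash N\mid\Delta$. $T\vdash A$ means $\vdash A\mid$ is derivable from axioms $T$. $\mathrm{PA}^\omega$: one base sort $\iota$, constants $s,k$ (combinators at all sorts), $0:\iota$, $S:\iota\to\iota$, $\mathrm{rec}:\sigma\to(\iota\to\sigma\to\sigma)\to\iota\to\sigma$, negative predicates $\neq_\sigma$, $t=u:=\neg(t\neq u)$. Axioms: $\forall x^\sigma(x=x)$; Leibniz $\forall\vec z\forall xy(\neg A\Rightarrow A[y/x]\Rightarrow x\neq y)$; $0$ is not a successor; induction $\forall\vec y(A[0/x]\Rightarrow\forall x(A\Rightarrow A[S\,x/x])\Rightarrow\forall xA)$ for formulas $A$ with free variables among $x^\iota,\vec y$; $\forall xyz(s\,x\,y\,z=x\,z\,(y\,z))$, $\forall xy(k\,x\,y=x)$,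 $\forall xy(\mathrm{rec}\,x\,y\,0=x)$, $\forall xyz(\mathrm{rec}\,x\,y\,(S\,z)=y\,z\,(\mathrm{rec}\,x\,y\,z))$. Relativization: add a positive predicate $\mathrm{Rel}$ on $\iota$; $\mathrm{Rel}(t^{\sigma\to\tau}):=\forall x^\sigma(\mathrm{Rel}(x)\Rightarrow\mathrm{Rel}(t\,x))$; $\forall^rxA:=\forall x(\mathrm{Rel}(x)\Rightarrow A)$; $P(\vec t)^r=P(\vec t)$, $\bot^r=\bot$, $(A\Rightarrow B)^r=A^r\Rightarrow B^r$, $(A\wedge B)^r=A^r\wedge B^r$, $(\forall xA)^r=\forall^rxA^r$. $\mathrm{PA}^\omega_r$ has the axioms of $\mathrm{PA}^\omega$ (unrelativized) except that induction is replaced by $\forall\vec y(A[0/x]\Rightarrow\forall^rx(A\Rightarrow A[S\,x/x])\Rightarrow\forall^rxA)$ for every formula $A$ over the extended signature with free variables among $x^\iota,\vec y$, together with $\mathrm{Rel}(0)$ and $\forall x^\iota(\mathrm{Rel}(x)\Rightarrow\mathrm{Rel}(S\,x))$. -}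

module Defs where

open import Data.List using (List; []; _∷_; map)
open import Data.List.Membership.Propositional using (_∈_)
open import Data.Sum using (_⊎_)

infixr 30 _⟶_
data Sort : Set where
  ι   : Sort
  _⟶_ : Sort → Sort → Sort

-- Variable contexts (typed de Bruijn; the head is the innermost binder)
Ctx : Set
Ctx = List Sort

infix 4 _∋_
data _∋_ : Ctx → Sort → Set where
  here  : ∀ {Ξ σ} → (σ ∷ Ξ) ∋ σ
  there : ∀ {Ξ σ τ} → Ξ ∋ σ → (τ ∷ Ξ) ∋ σ

infixl 40 _·_
data Term (Ξ : Ctx) : Sort → Set where
  var  : ∀ {σ} → Ξ ∋ σ → Term Ξ σ
  `0   : Term Ξ ι
  `S   : Term Ξ (ι ⟶ ι)
  `k   : ∀ σ τ → Term Ξ (σ ⟶ τ ⟶ σ)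
  `s   : ∀ σ τ ρ → Term Ξ ((σ ⟶ τ ⟶ ρ) ⟶ (σ ⟶ τ) ⟶ σ ⟶ ρ)
  `rec : ∀ σ → Term Ξ (σ ⟶ (ι ⟶ σ ⟶ σ) ⟶ ι ⟶ σ)
  _·_  : ∀ {σ τ} → Term Ξ (σ ⟶ τ) → Term Ξ σ → Term Ξ τ

-- Languages: PA^ω (predicates ≠_σ, all negative) and its extension
-- by the positive predicate Rel on ι.

data Lang : Set where
  LPA LPAr : Lang

infix  35 _≠_
infixr 20 _`⇒_
infixr 25 _`∧_
data Formula : Lang → Ctx → Set where
  _≠_  : ∀ {L Ξ σ} → Term Ξ σ → Term Ξ σ → Formula L Ξ
  Rel  : ∀ {Ξ} → Term Ξ ι → Formula LPAr Ξ
  `⊥   : ∀ {L Ξ} → Formula L Ξ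
  _`⇒_ : ∀ {L Ξ} → Formula L Ξ → Formula L Ξ → Formula L Ξ
  _`∧_ : ∀ {L Ξ} → Formula L Ξ → Formula L Ξ → Formula L Ξ
  `∀   : ∀ {L Ξ σ} → Formula L (σ ∷ Ξ) → Formula L Ξ

`¬_ : ∀ {L Ξ} → Formula L Ξ → Formula L Ξ
`¬ A = A `⇒ `⊥

infix 35 _==_
_==_ : ∀ {L Ξ σ} → Term Ξ σ → Term Ξ σ → Formula L Ξ
t == u = `¬ (t ≠ u)

data Negative : ∀ {L Ξ} → Formula L Ξ → Set where
  neg-≠ : ∀ {L Ξ σ} {t u : Term Ξ σ} → Negative {L} (t ≠ u)
  neg-⊥ : ∀ {L Ξ} → Negative {L} {Ξ} `⊥
  neg-⇒ : ∀ {L Ξ} {A N : Formula L Ξ} → Negative N → Negative (A `⇒ N)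
  neg-∧ : ∀ {L Ξ} {N N' : Formula L Ξ} → Negative N → Negative N' → Negative (N `∧ N')
  neg-∀ : ∀ {L Ξ σ} {N : Formula L (σ ∷ Ξ)} → Negative N → Negative (`∀ N)

Ren : Ctx → Ctx → Set
Ren Ξ Ξ' = ∀ {σ} → Ξ ∋ σ → Ξ' ∋ σ

liftR : ∀ {Ξ Ξ' τ} → Ren Ξ Ξ' → Ren (τ ∷ Ξ) (τ ∷ Ξ')
liftR ρ here      = here
liftR ρ (there x) = there (ρ x)

renT : ∀ {Ξ Ξ' σ} → Ren Ξ Ξ' → Term Ξ σ → Term Ξ' σ
renT ρ (var x)    = var (ρ x)
renT ρ `0         = `0
renT ρ `S         = `S
renT ρ (`k σ τ)   = `k σ τ
renT ρ (`s σ τ υ) = `s σ τ υ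
renT ρ (`rec σ)   = `rec σ
renT ρ (t · u)    = renT ρ t · renT ρ u

renF : ∀ {L Ξ Ξ'} → Ren Ξ Ξ' → Formula L Ξ → Formula L Ξ'
renF ρ (t ≠ u)  = renT ρ t ≠ renT ρ u
renF ρ (Rel t)  = Rel (renT ρ t)
renF ρ `⊥       = `⊥
renF ρ (A `⇒ B) = renF ρ A `⇒ renF ρ B
renF ρ (A `∧ B) = renF ρ A `∧ renF ρ B
renF ρ (`∀ A)   = `∀ (renF (liftR ρ) A)

wkT : ∀ {Ξ σ τ} → Term Ξ σ → Term (τ ∷ Ξ) σ
wkT = renT there

wkF : ∀ {L Ξ τ} → Formula L Ξ → Formula L (τ ∷ Ξ)
wkF = renF there

closedR : ∀ {Ξ} → Ren [] Ξ
closedR ()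

Sub : Ctx → Ctx → Set
Sub Ξ Ξ' = ∀ {σ} → Ξ ∋ σ → Term Ξ' σ

liftS : ∀ {Ξ Ξ' τ} → Sub Ξ Ξ' → Sub (τ ∷ Ξ) (τ ∷ Ξ')
liftS θ here      = var here
liftS θ (there x) = wkT (θ x)

subT : ∀ {Ξ Ξ' σ} → Sub Ξ Ξ' → Term Ξ σ → Term Ξ' σ
subT θ (var x)    = θ x
subT θ `0         = `0
subT θ `S         = `S
subT θ (`k σ τ)   = `k σ τ
subT θ (`s σ τ υ) = `s σ τ υ
subT θ (`rec σ)   = `rec σ
subT θ (t · u)    = subT θ t · subT θ u

subF : ∀ {L Ξ Ξ'} → Sub Ξ Ξ' → Formula L Ξ → Formula L Ξ'
subF θ (t ≠ u)  = subT θ t ≠ subT θ u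
subF θ (Rel t)  = Rel (subT θ t)
subF θ `⊥       = `⊥
subF θ (A `⇒ B) = subF θ A `⇒ subF θ B
subF θ (A `∧ B) = subF θ A `∧ subF θ B
subF θ (`∀ A)   = `∀ (subF (liftS θ) A)

sub₀ : ∀ {Ξ σ} → Term Ξ σ → Sub (σ ∷ Ξ) Ξ
sub₀ t here      = t
sub₀ t (there x) = var x

infix 50 _[_]
_[_] : ∀ {L Ξ σ} → Formula L (σ ∷ Ξ) → Term Ξ σ → Formula L Ξ
A [ t ] = subF (sub₀ t) A

subSucc : ∀ {Ξ} → Sub (ι ∷ Ξ) (ι ∷ Ξ)
subSucc here      = `S · var here
subSucc (there x) = var (there x)

-- universal closure  ∀Ξ A  (the head of Ξ is bound innermost)
∀* : ∀ {L} (Ξ : Ctx) → Formula L Ξ → Formula L []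
∀* []      A = A
∀* (σ ∷ Ξ) A = ∀* Ξ (`∀ A)

-- The sequent calculus  Γ ⊢ A | Δ  over axioms T (closed formulas)

Theory : Lang → Set₁
Theory L = Formula L [] → Set

data Deriv {L : Lang} (T : Theory L) {Ξ : Ctx} :
       List (Formula L Ξ) → Formula L Ξ → List (Formula L Ξ) → Set where
  idt   : ∀ {Γ Δ A} → A ∈ Γ → Deriv T Γ A Δ
  axm   : ∀ {Γ Δ A} → T A → Deriv T Γ (renF closedR A) Δ
  ⇒I    : ∀ {Γ Δ A B} → Deriv T (A ∷ Γ) B Δ → Deriv T Γ (A `⇒ B) Δ
  ⇒E    : ∀ {Γ Δ A B} → Deriv T Γ (A `⇒ B) Δ → Deriv T Γ A Δ → Deriv T Γ B Δ
  ∧I    : ∀ {Γ Δ A B} → Deriv T Γ A Δ → Deriv T Γ B Δ → Deriv T Γ (A `∧ B) Δ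
  ∧E₁   : ∀ {Γ Δ A B} → Deriv T Γ (A `∧ B) Δ → Deriv T Γ A Δ
  ∧E₂   : ∀ {Γ Δ A B} → Deriv T Γ (A `∧ B) Δ → Deriv T Γ B Δ
  ∀I    : ∀ {Γ Δ σ} {A : Formula L (σ ∷ Ξ)} →
          Deriv T {σ ∷ Ξ} (map wkF Γ) A (map wkF Δ) → Deriv T Γ (`∀ A) Δ
  ∀E    : ∀ {Γ Δ σ} {A : Formula L (σ ∷ Ξ)} →
          Deriv T Γ (`∀ A) Δ → (t : Term Ξ σ) → Deriv T Γ (A [ t ]) Δ
  throw : ∀ {Γ Δ N} → N ∈ Δ → Deriv T Γ N Δ → Deriv T Γ `⊥ Δ
  catch : ∀ {Γ Δ N} → Negative N → Deriv T Γ `⊥ (N ∷ Δ) → Deriv T Γ N Δ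

infix 4 _⊩_
_⊩_ : ∀ {L} → Theory L → Formula L [] → Set
T ⊩ A = Deriv T {[]} [] A []

data IndAx (L : Lang) : Theory L where
  ind : (Ξ : Ctx) (A : Formula L (ι ∷ Ξ)) →
        IndAx L (∀* Ξ (A [ `0 ] `⇒ `∀ (A `⇒ subF subSucc A) `⇒ `∀ A))

-- renamings used for Leibniz: x ↦ index 1, resp. x ↦ index 0 (= y)
toX : ∀ {Ξ σ} → Ren (σ ∷ Ξ) (σ ∷ σ ∷ Ξ)
toX here      = there here
toX (there v) = there (there v)

toY : ∀ {Ξ σ} → Ren (σ ∷ Ξ) (σ ∷ σ ∷ Ξ)
toY here      = here
toY (there v) = there (there v)

data BaseAx : Theory LPA where
  eqRefl   : ∀ σ → BaseAx (`∀ {σ = σ} (var here == var here))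
  leibniz  : (Ξ : Ctx) (σ : Sort) (A : Formula LPA (σ ∷ Ξ)) →
             BaseAx (∀* Ξ (`∀ (`∀ ((`¬ renF toX A) `⇒ renF toY A `⇒
                       var (there here) ≠ var here))))
  zeroNotS : BaseAx (`∀ (`S · var here ≠ `0))
  sAx      : ∀ σ τ ρ →
             BaseAx (∀* (σ ∷ (σ ⟶ τ) ∷ (σ ⟶ τ ⟶ ρ) ∷ [])
               (`s σ τ ρ · var (there (there here)) · var (there here) · var here
                 == var (there (there here)) · var here · (var (there here) · var here)))
  kAx      : ∀ σ τ →
             BaseAx (∀* (τ ∷ σ ∷ []) (`k σ τ · var (there here) · var here == var (there here)))
  rec0Ax   : ∀ σ →
             BaseAx (∀* ((ι ⟶ σ ⟶ σ) ∷ σ ∷ [])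
               (`rec σ · var (there here) · var here · `0 == var (there here)))
  recSAx   : ∀ σ →
             BaseAx (∀* (ι ∷ (ι ⟶ σ ⟶ σ) ∷ σ ∷ [])
               (`rec σ · var (there (there here)) · var (there here) · (`S · var here)
                 == var (there here) · var here
                      · (`rec σ · var (there (there here)) · var (there here) · var here)))

PAω : Theory LPA
PAω A = BaseAx A ⊎ IndAx LPA A

emb : ∀ {Ξ} → Formula LPA Ξ → Formula LPAr Ξ
emb (t ≠ u)  = t ≠ u
emb `⊥       = `⊥
emb (A `⇒ B) = emb A `⇒ emb B
emb (A `∧ B) = emb A `∧ emb B
emb (`∀ A)   = `∀ (emb A)

RelS : ∀ {Ξ} (σ : Sort) → Term Ξ σ → Formula LPAr Ξ
RelS ι       t = Rel t
RelS (σ ⟶ τ) t = `∀ (RelS σ (var here) `⇒ RelS τ (wkT t · var here))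

∀r : ∀ {Ξ σ} → Formula LPAr (σ ∷ Ξ) → Formula LPAr Ξ
∀r {σ = σ} A = `∀ (RelS σ (var here) `⇒ A)

infix 50 _ʳ
_ʳ : ∀ {Ξ} → Formula LPA Ξ → Formula LPAr Ξ
(t ≠ u) ʳ  = t ≠ u
`⊥ ʳ       = `⊥
(A `⇒ B) ʳ = A ʳ `⇒ B ʳ
(A `∧ B) ʳ = A ʳ `∧ B ʳ
(`∀ A) ʳ   = ∀r (A ʳ)

data PAωr : Theory LPAr where
  base  : ∀ {A} → BaseAx A → PAωr (emb A)
  indr  : (Ξ : Ctx) (A : Formula LPAr (ι ∷ Ξ)) →
          PAωr (∀* Ξ (A [ `0 ] `⇒ ∀r (A `⇒ subF subSucc A) `⇒ ∀r A))
  rel0  : PAωr (Rel `0)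
  relS  : PAωr (`∀ (Rel (var here) `⇒ Rel (`S · var here)))

module Submission where

open import Data.List using (List; []; _∷_)
open import Data.List.Membership.Propositional using (_∈_)
open import Data.List.Membership.Propositional.Properties using (∈-map⁺)
import Data.List.Relation.Unary.Any as Any
open import Data.Sum using (inj₁; inj₂)
open import Relation.Binary.PropositionalEquality
  using (_≡_; refl; sym; trans; cong; cong₂; subst)
open import Defs

-- Relativization commutes with substitution.  Hence the relativized induction
-- axiom for A is the PAω_r induction axiom for Aʳ, and a universal closure of a
-- quantifier-free axiom relativizes to a consequence of itself: instantiate it at
-- the relativized variables.  Leibniz is the only real work, since its
-- relativization speaks about Aʳ, which is not a PAω formula.  We prove the
-- transport Aʳ[x] ⇒ Aʳ[y] by induction on A, using Leibniz only for atoms, under a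
-- stack Δ holding x ≠ y and y ≠ x: an atom true at x and false at y yields y ≠ x by
-- Leibniz, which is thrown.  Both directions are on the stack because implication
-- reverses the direction of transport.

infix 4 _≐_
_≐_ : ∀ {Ξ Ξ'} → Sub Ξ Ξ' → Sub Ξ Ξ' → Set
_≐_ {Ξ} θ θ' = ∀ {σ} (v : Ξ ∋ σ) → θ v ≡ θ' v

subT-cong : ∀ {Ξ Ξ' σ} {θ θ' : Sub Ξ Ξ'} → θ ≐ θ' → (t : Term Ξ σ) → subT θ t ≡ subT θ' t
subT-cong h (var x)    = h x
subT-cong h `0         = refl
subT-cong h `S         = refl
subT-cong h (`k σ τ)   = refl
subT-cong h (`s σ τ ρ) = refl
subT-cong h (`rec σ)   = refl
subT-cong h (t · u)    = cong₂ _·_ (subT-cong h t) (subT-cong h u)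

subT-id : ∀ {Ξ σ} {θ : Sub Ξ Ξ} → θ ≐ var → (t : Term Ξ σ) → subT θ t ≡ t
subT-id h (var x)    = h x
subT-id h `0         = refl
subT-id h `S         = refl
subT-id h (`k σ τ)   = refl
subT-id h (`s σ τ ρ) = refl
subT-id h (`rec σ)   = refl
subT-id h (t · u)    = cong₂ _·_ (subT-id h t) (subT-id h u)

subT-subT : ∀ {Ξ Ξ' Ξ'' σ} (θ₂ : Sub Ξ' Ξ'') (θ₁ : Sub Ξ Ξ') (t : Term Ξ σ) →
            subT θ₂ (subT θ₁ t) ≡ subT (λ v → subT θ₂ (θ₁ v)) t
subT-subT θ₂ θ₁ (var x)    = refl
subT-subT θ₂ θ₁ `0         = refl
subT-subT θ₂ θ₁ `S         = refl
subT-subT θ₂ θ₁ (`k σ τ)   = refl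
subT-subT θ₂ θ₁ (`s σ τ ρ) = refl
subT-subT θ₂ θ₁ (`rec σ)   = refl
subT-subT θ₂ θ₁ (t · u)    = cong₂ _·_ (subT-subT θ₂ θ₁ t) (subT-subT θ₂ θ₁ u)

renT-as-subT : ∀ {Ξ Ξ' σ} (ρ : Ren Ξ Ξ') (t : Term Ξ σ) → renT ρ t ≡ subT (λ v → var (ρ v)) t
renT-as-subT ρ (var x)    = refl
renT-as-subT ρ `0         = refl
renT-as-subT ρ `S         = refl
renT-as-subT ρ (`k σ τ)   = refl
renT-as-subT ρ (`s σ τ υ) = refl
renT-as-subT ρ (`rec σ)   = refl
renT-as-subT ρ (t · u)    = cong₂ _·_ (renT-as-subT ρ t) (renT-as-subT ρ u)

subT-renT : ∀ {Ξ Ξ' Ξ'' σ} (θ : Sub Ξ' Ξ'') (ρ : Ren Ξ Ξ') (t : Term Ξ σ) →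
            subT θ (renT ρ t) ≡ subT (λ v → θ (ρ v)) t
subT-renT θ ρ t = trans (cong (subT θ) (renT-as-subT ρ t)) (subT-subT θ _ t)

renT-subT : ∀ {Ξ Ξ' Ξ'' σ} (ρ : Ren Ξ' Ξ'') (θ : Sub Ξ Ξ') (t : Term Ξ σ) →
            renT ρ (subT θ t) ≡ subT (λ v → renT ρ (θ v)) t
renT-subT ρ θ t =
  trans (renT-as-subT ρ (subT θ t))
        (trans (subT-subT _ θ t) (subT-cong (λ v → sym (renT-as-subT ρ (θ v))) t))

liftS-wkT : ∀ {Ξ Ξ' σ τ} (θ : Sub Ξ Ξ') (t : Term Ξ σ) →
            subT (liftS {τ = τ} θ) (wkT t) ≡ wkT (subT θ t)
liftS-wkT θ t = trans (subT-renT (liftS θ) there t) (sym (renT-subT there θ t))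

sub₀-wkT : ∀ {Ξ σ τ} (u : Term Ξ τ) (t : Term Ξ σ) → subT (sub₀ u) (wkT t) ≡ t
sub₀-wkT u t = trans (subT-renT (sub₀ u) there t) (subT-id (λ _ → refl) t)

wkT-sub₀ : ∀ {Ξ σ τ ρ} (x : Term Ξ σ) (t : Term (σ ∷ Ξ) ρ) →
           wkT {τ = τ} (subT (sub₀ x) t) ≡ subT (sub₀ (wkT x)) (renT (liftR there) t)
wkT-sub₀ x t =
  trans (renT-subT there (sub₀ x) t)
        (sym (trans (subT-renT _ (liftR there) t)
                    (subT-cong (λ { here → refl ; (there _) → refl }) t)))

liftS-cong : ∀ {Ξ Ξ' τ} {θ θ' : Sub Ξ Ξ'} → θ ≐ θ' → liftS {τ = τ} θ ≐ liftS θ'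
liftS-cong h here      = refl
liftS-cong h (there v) = cong wkT (h v)

subF-cong : ∀ {L Ξ Ξ'} {θ θ' : Sub Ξ Ξ'} → θ ≐ θ' → (A : Formula L Ξ) → subF θ A ≡ subF θ' A
subF-cong h (t ≠ u)  = cong₂ _≠_ (subT-cong h t) (subT-cong h u)
subF-cong h (Rel t)  = cong Rel (subT-cong h t)
subF-cong h `⊥       = refl
subF-cong h (A `⇒ B) = cong₂ _`⇒_ (subF-cong h A) (subF-cong h B)
subF-cong h (A `∧ B) = cong₂ _`∧_ (subF-cong h A) (subF-cong h B)
subF-cong h (`∀ A)   = cong `∀ (subF-cong (liftS-cong h) A)

liftS-id : ∀ {Ξ τ} {θ : Sub Ξ Ξ} → θ ≐ var → liftS {τ = τ} θ ≐ var
liftS-id h here      = refl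
liftS-id h (there v) = cong wkT (h v)

subF-id : ∀ {L Ξ} {θ : Sub Ξ Ξ} → θ ≐ var → (A : Formula L Ξ) → subF θ A ≡ A
subF-id h (t ≠ u)  = cong₂ _≠_ (subT-id h t) (subT-id h u)
subF-id h (Rel t)  = cong Rel (subT-id h t)
subF-id h `⊥       = refl
subF-id h (A `⇒ B) = cong₂ _`⇒_ (subF-id h A) (subF-id h B)
subF-id h (A `∧ B) = cong₂ _`∧_ (subF-id h A) (subF-id h B)
subF-id h (`∀ A)   = cong `∀ (subF-id (liftS-id h) A)

liftS-subT : ∀ {Ξ Ξ' Ξ'' τ} (θ₂ : Sub Ξ' Ξ'') (θ₁ : Sub Ξ Ξ') →
             (λ v → subT (liftS θ₂) (liftS {τ = τ} θ₁ v)) ≐ liftS (λ v → subT θ₂ (θ₁ v))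
liftS-subT θ₂ θ₁ here      = refl
liftS-subT θ₂ θ₁ (there v) = liftS-wkT θ₂ (θ₁ v)

subF-subF : ∀ {L Ξ Ξ' Ξ''} (θ₂ : Sub Ξ' Ξ'') (θ₁ : Sub Ξ Ξ') (A : Formula L Ξ) →
            subF θ₂ (subF θ₁ A) ≡ subF (λ v → subT θ₂ (θ₁ v)) A
subF-subF θ₂ θ₁ (t ≠ u)  = cong₂ _≠_ (subT-subT θ₂ θ₁ t) (subT-subT θ₂ θ₁ u)
subF-subF θ₂ θ₁ (Rel t)  = cong Rel (subT-subT θ₂ θ₁ t)
subF-subF θ₂ θ₁ `⊥       = refl
subF-subF θ₂ θ₁ (A `⇒ B) = cong₂ _`⇒_ (subF-subF θ₂ θ₁ A) (subF-subF θ₂ θ₁ B)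
subF-subF θ₂ θ₁ (A `∧ B) = cong₂ _`∧_ (subF-subF θ₂ θ₁ A) (subF-subF θ₂ θ₁ B)
subF-subF θ₂ θ₁ (`∀ A)   =
  cong `∀ (trans (subF-subF (liftS θ₂) (liftS θ₁) A) (subF-cong (liftS-subT θ₂ θ₁) A))

renF-as-subF : ∀ {L Ξ Ξ'} (ρ : Ren Ξ Ξ') (A : Formula L Ξ) → renF ρ A ≡ subF (λ v → var (ρ v)) A
renF-as-subF ρ (t ≠ u)  = cong₂ _≠_ (renT-as-subT ρ t) (renT-as-subT ρ u)
renF-as-subF ρ (Rel t)  = cong Rel (renT-as-subT ρ t)
renF-as-subF ρ `⊥       = refl
renF-as-subF ρ (A `⇒ B) = cong₂ _`⇒_ (renF-as-subF ρ A) (renF-as-subF ρ B)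
renF-as-subF ρ (A `∧ B) = cong₂ _`∧_ (renF-as-subF ρ A) (renF-as-subF ρ B)
renF-as-subF ρ (`∀ A)   =
  cong `∀ (trans (renF-as-subF (liftR ρ) A) (subF-cong (λ { here → refl ; (there _) → refl }) A))

wkF-∀-instance : ∀ {L Ξ τ} (A : Formula L (τ ∷ Ξ)) → renF (liftR there) A [ var here ] ≡ A
wkF-∀-instance A =
  trans (cong (subF _) (renF-as-subF (liftR there) A))
        (trans (subF-subF _ _ A) (subF-id (λ { here → refl ; (there _) → refl }) A))

RelS-sub : ∀ {Ξ Ξ'} (θ : Sub Ξ Ξ') σ (t : Term Ξ σ) → subF θ (RelS σ t) ≡ RelS σ (subT θ t)
RelS-sub θ ι       t = refl
RelS-sub θ (σ ⟶ τ) t =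
  cong `∀ (cong₂ _`⇒_ (RelS-sub (liftS θ) σ (var here))
                      (trans (RelS-sub (liftS θ) τ (wkT t · var here))
                             (cong (λ s → RelS τ (s · var here)) (liftS-wkT θ t))))

ʳ-sub : ∀ {Ξ Ξ'} (θ : Sub Ξ Ξ') (A : Formula LPA Ξ) → subF θ A ʳ ≡ subF θ (A ʳ)
ʳ-sub θ (t ≠ u)          = refl
ʳ-sub θ `⊥               = refl
ʳ-sub θ (A `⇒ B)         = cong₂ _`⇒_ (ʳ-sub θ A) (ʳ-sub θ B)
ʳ-sub θ (A `∧ B)         = cong₂ _`∧_ (ʳ-sub θ A) (ʳ-sub θ B)
ʳ-sub θ (`∀ {σ = σ} A) =
  cong `∀ (cong₂ _`⇒_ (sym (RelS-sub (liftS θ) σ (var here))) (ʳ-sub (liftS θ) A))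

emb-∀* : (Ξ : Ctx) (D : Formula LPA Ξ) → emb (∀* Ξ D) ≡ ∀* Ξ (emb D)
emb-∀* []      D = refl
emb-∀* (σ ∷ Ξ) D = emb-∀* Ξ (`∀ D)

cast : ∀ {L} {T : Theory L} {Ξ} {Γ Δ : List (Formula L Ξ)} {A B : Formula L Ξ} →
       A ≡ B → Deriv T Γ A Δ → Deriv T Γ B Δ
cast refl d = d

∀*E : ∀ {L} {T : Theory L} {Ξ Ξ'} {Γ Δ : List (Formula L Ξ')} (D : Formula L Ξ) →
      T (∀* Ξ D) → (θ : Sub Ξ Ξ') → Deriv T Γ (subF θ D) Δ
∀*E {Ξ = []}    D ax θ = cast (trans (renF-as-subF closedR D) (subF-cong (λ ()) D)) (axm ax)
∀*E {Ξ = τ ∷ Ξ} D ax θ =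
  cast (trans (subF-subF _ _ D) (subF-cong instance-θ D))
       (∀E (∀*E (`∀ D) ax (λ v → θ (there v))) (θ here))
  where
  instance-θ : (λ v → subT (sub₀ (θ here)) (liftS (λ w → θ (there w)) v)) ≐ θ
  instance-θ here      = refl
  instance-θ (there v) = sub₀-wkT (θ here) (θ (there v))

axm-open : ∀ {L} {T : Theory L} (Ξ : Ctx) {Γ Δ : List (Formula L Ξ)} (D : Formula L Ξ) →
           T (∀* Ξ D) → Deriv T Γ D Δ
axm-open Ξ D ax = cast (subF-id (λ _ → refl) D) (∀*E D ax var)

∀E-fresh : ∀ {L} {T : Theory L} {Ξ τ} {Γ Δ : List (Formula L (τ ∷ Ξ))} {A : Formula L (τ ∷ Ξ)} →
           Deriv T Γ (wkF (`∀ A)) Δ → Deriv T Γ A Δ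
∀E-fresh {A = A} d = cast (wkF-∀-instance A) (∀E d (var here))

closureʳ : ∀ {T : Theory LPAr} (Ξ : Ctx) (D : Formula LPA Ξ) →
           (∀ Γ → Deriv T {Ξ} Γ (D ʳ) []) → T ⊩ ∀* Ξ D ʳ
closureʳ []      D d = d []
closureʳ (σ ∷ Ξ) D d = closureʳ Ξ (`∀ D) (λ _ → ∀I (⇒I (d _)))

base-∀* : (Ξ : Ctx) (D : Formula LPA Ξ) → BaseAx (∀* Ξ D) → PAωr (∀* Ξ (emb D))
base-∀* Ξ D ax = subst PAωr (emb-∀* Ξ D) (base ax)

=-refl : ∀ {Ξ σ} {Γ Δ : List (Formula LPAr Ξ)} (x : Term Ξ σ) → Deriv PAωr Γ (x == x) Δ
=-refl {σ = σ} x = ∀E (axm (base (eqRefl σ))) x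

leibniz-≠ : ∀ {Ξ σ τ} {Γ Δ : List (Formula LPAr Ξ)} (t u : Term (σ ∷ Ξ) τ) (a b : Term Ξ σ) →
            Deriv PAωr Γ ((`¬ (subT (sub₀ a) t ≠ subT (sub₀ a) u)) `⇒
                          subT (sub₀ b) t ≠ subT (sub₀ b) u `⇒ a ≠ b) Δ
leibniz-≠ {Ξ} {σ} t u a b =
  cast (cong₂ (λ P Q → (`¬ P) `⇒ Q `⇒ a ≠ b)
              (cong₂ _≠_ (atX t) (atX u)) (cong₂ _≠_ (atY t) (atY u)))
       (∀*E {Ξ = σ ∷ σ ∷ Ξ} _ (base-∀* (σ ∷ σ ∷ Ξ) _ (leibniz Ξ σ (t ≠ u))) θ)
  where
  θ : Sub (σ ∷ σ ∷ Ξ) Ξ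
  θ here              = b
  θ (there here)      = a
  θ (there (there v)) = var v
  atX : ∀ {ρ} (s : Term (σ ∷ Ξ) ρ) → subT θ (renT toX s) ≡ subT (sub₀ a) s
  atX s = trans (subT-renT θ toX s) (subT-cong (λ { here → refl ; (there _) → refl }) s)
  atY : ∀ {ρ} (s : Term (σ ∷ Ξ) ρ) → subT θ (renT toY s) ≡ subT (sub₀ b) s
  atY s = trans (subT-renT θ toY s) (subT-cong (λ { here → refl ; (there _) → refl }) s)

≠-sym : ∀ {Ξ σ} {Γ Δ : List (Formula LPAr Ξ)} {x y : Term Ξ σ} →
        Deriv PAωr Γ (y ≠ x) Δ → Deriv PAωr Γ (x ≠ y) Δ
≠-sym {x = x} {y} d =
  ⇒E (⇒E (cast (cong₂ (λ s t → (`¬ (x ≠ s)) `⇒ y ≠ t `⇒ x ≠ y) (sub₀-wkT x x) (sub₀-wkT y x))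
                  (leibniz-≠ (var here) (wkT x) x y))
          (=-refl x))
     d

-- Transporting A under θ⟪x⟫, rather than A[x] itself, is what lets the ∀ case
-- recurse: there θ↑ moves the newly bound variable below the transported one.
_⟪_⟫ : ∀ {Ξ₀ Ξ σ} → Sub Ξ₀ (σ ∷ Ξ) → Term Ξ σ → Sub Ξ₀ Ξ
(θ ⟪ x ⟫) v = subT (sub₀ x) (θ v)

transportʳ : ∀ {Ξ₀ Ξ σ} (A : Formula LPA Ξ₀) (θ : Sub Ξ₀ (σ ∷ Ξ)) {x y : Term Ξ σ}
             {Γ Δ : List (Formula LPAr Ξ)} → (x ≠ y) ∈ Δ → (y ≠ x) ∈ Δ →
             Deriv PAωr Γ (subF (θ ⟪ x ⟫) A ʳ `⇒ subF (θ ⟪ y ⟫) A ʳ) Δ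
transportʳ {Ξ = Ξ} (t ≠ u) θ {x} {y} _ yx =
  ⇒I (catch neg-≠ (throw (Any.there yx)
    (⇒E (⇒E (cast (cong₂ (λ P Q → (`¬ P) `⇒ Q `⇒ y ≠ x) (atom y) (atom x))
                    (leibniz-≠ (subT θ t) (subT θ u) y x))
              (⇒I (throw (Any.here refl) (idt (Any.here refl)))))
        (idt (Any.here refl)))))
  where
  atom : (z : Term Ξ _) →
         _≡_ {A = Formula LPAr Ξ} (subT (sub₀ z) (subT θ t) ≠ subT (sub₀ z) (subT θ u))
                                  (subT (θ ⟪ z ⟫) t ≠ subT (θ ⟪ z ⟫) u)
  atom z = cong₂ _≠_ (subT-subT (sub₀ z) θ t) (subT-subT (sub₀ z) θ u)
transportʳ `⊥ θ _ _ = ⇒I (idt (Any.here refl))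
transportʳ (A `⇒ B) θ xy yx =
  ⇒I (⇒I (⇒E (transportʳ B θ xy yx)
             (⇒E (idt (Any.there (Any.here refl)))
                 (⇒E (transportʳ A θ yx xy) (idt (Any.here refl))))))
transportʳ (A `∧ B) θ xy yx =
  ⇒I (∧I (⇒E (transportʳ A θ xy yx) (∧E₁ (idt (Any.here refl))))
         (⇒E (transportʳ B θ xy yx) (∧E₂ (idt (Any.here refl)))))
transportʳ {Ξ₀} {Ξ} {σ} (`∀ {σ = τ} A) θ {x} {y} xy yx =
  ⇒I (∀I (⇒I (cast (under-binder y)
    (⇒E (transportʳ A θ↑ (∈-map⁺ wkF xy) (∈-map⁺ wkF yx))
        (cast (sym (under-binder x))
              (⇒E (∀E-fresh (idt (Any.there (Any.here refl)))) (idt (Any.here refl))))))))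
  where
  θ↑ : Sub (τ ∷ Ξ₀) (σ ∷ τ ∷ Ξ)
  θ↑ here      = var (there here)
  θ↑ (there v) = renT (liftR there) (θ v)
  under-binder : (z : Term Ξ σ) → subF (θ↑ ⟪ wkT z ⟫) A ʳ ≡ subF (liftS (θ ⟪ z ⟫)) A ʳ
  under-binder z = cong _ʳ (subF-cong (λ { here → refl ; (there v) → sym (wkT-sub₀ z (θ v)) }) A)

leibnizʳ : ∀ {Ξ σ} (A : Formula LPA (σ ∷ Ξ)) {Γ Δ : List (Formula LPAr (σ ∷ σ ∷ Ξ))} →
           Deriv PAωr Γ (((`¬ renF toX A) `⇒ renF toY A `⇒ var (there here) ≠ var here) ʳ) Δ
leibnizʳ {Ξ} {σ} A =
  ⇒I (⇒I (catch neg-≠ (throw (Any.here refl) (≠-sym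
    (catch neg-≠ (⇒E (idt (Any.there (Any.here refl)))
      (cast (sym atX)
        (⇒E (transportʳ A θ (Any.here refl) (Any.there (Any.here refl)))
            (cast atY (idt (Any.here refl)))))))))))
  where
  θ : Sub (σ ∷ Ξ) (σ ∷ σ ∷ σ ∷ Ξ)
  θ v = var (liftR (λ w → there (there w)) v)
  atX : renF toX A ʳ ≡ subF (θ ⟪ var (there here) ⟫) A ʳ
  atX = cong _ʳ (trans (renF-as-subF toX A) (subF-cong (λ { here → refl ; (there _) → refl }) A))
  atY : renF toY A ʳ ≡ subF (θ ⟪ var here ⟫) A ʳ
  atY = cong _ʳ (trans (renF-as-subF toY A) (subF-cong (λ { here → refl ; (there _) → refl }) A))

inductionʳ : ∀ {Ξ} (A : Formula LPA (ι ∷ Ξ)) {Γ Δ : List (Formula LPAr Ξ)} →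
             Deriv PAωr Γ ((A [ `0 ] `⇒ `∀ (A `⇒ subF subSucc A) `⇒ `∀ A) ʳ) Δ
inductionʳ {Ξ} A =
  cast (sym (cong₂ _`⇒_ (ʳ-sub (sub₀ `0) A)
                        (cong (λ B → ∀r (A ʳ `⇒ B) `⇒ ∀r (A ʳ)) (ʳ-sub subSucc A))))
       (axm-open Ξ _ (indr Ξ (A ʳ)))

universal-axiomʳ : (Ξ : Ctx) {D : Formula LPA Ξ} → D ʳ ≡ emb D → BaseAx (∀* Ξ D) → PAωr ⊩ ∀* Ξ D ʳ
universal-axiomʳ Ξ {D} Dʳ≡D ax =
  closureʳ Ξ D (λ _ → cast (sym Dʳ≡D) (axm-open Ξ (emb D) (base-∀* Ξ D ax)))

mainTheorem12 : (A : Formula LPA []) → PAω A → PAωr ⊩ A ʳ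
mainTheorem12 _ (inj₁ (eqRefl σ))      = universal-axiomʳ (σ ∷ []) refl (eqRefl σ)
mainTheorem12 _ (inj₁ zeroNotS)        = universal-axiomʳ (ι ∷ []) refl zeroNotS
mainTheorem12 _ (inj₁ (sAx σ τ ρ))     =
  universal-axiomʳ (σ ∷ (σ ⟶ τ) ∷ (σ ⟶ τ ⟶ ρ) ∷ []) refl (sAx σ τ ρ)
mainTheorem12 _ (inj₁ (kAx σ τ))       = universal-axiomʳ (τ ∷ σ ∷ []) refl (kAx σ τ)
mainTheorem12 _ (inj₁ (rec0Ax σ))      = universal-axiomʳ ((ι ⟶ σ ⟶ σ) ∷ σ ∷ []) refl (rec0Ax σ)
mainTheorem12 _ (inj₁ (recSAx σ))      = universal-axiomʳ (ι ∷ (ι ⟶ σ ⟶ σ) ∷ σ ∷ []) refl (recSAx σ)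
mainTheorem12 _ (inj₁ (leibniz Ξ σ A)) = closureʳ (σ ∷ σ ∷ Ξ) _ (λ _ → leibnizʳ A)
mainTheorem12 _ (inj₂ (ind Ξ A))       = closureʳ Ξ _ (λ _ → inductionʳ A)
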